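{- Let $\beta=1.6740$ and $n\geq 11$. Let $S_n$ be the set of all non-decreasing sequences $s=(s_1,\dots,s_n)$ of integers satisfying $\sum_{v=1}^k s_v\geq \binom{k}{2}+1$ for all $k=1,\dots,n-1$, $\sum_{v=1}^n s_v=\binom{n}{2}$, and $3\leq s_1\leq\dots\leq s_n\leq n-4$. Define $G:S_n\to\mathbb{R}_+$ by $G(s)=\sum_{v=1}^n \beta^{s_v}$. Define the sequence $\sigma(n)$ by $\sigma(11)=(3,3,3,3,3,5,7,7,7,7,7)$, $\sigma(12)=(3,3,3,3,3,3,8,8,8,8,8,8)$, $\sigma(13)=(3,3,3,3,3,3,6,9,9,9,9,9,9)$, and, for $n\geq 14$, $\sigma(n)=(3,3,3,3,3,3,4,7,8,\dots,n-9,n-8,n-5,n-4,n-4,n-4,n-4,n-4,n-4)$ (six entries $3$, then $4$, then all integers from $7$ to $n-8$ in increasing order, then $n-5$, then six entries $n-4$). Then $\sigma(n)\in S_n$ and $G(s)\leq G(\sigma(n))$ for all $s\in S_n$. -}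

module Defs where

import Data.Nat
open import Data.Nat using (ℕ; zero; suc; _∸_; _≤_; _<_)
open import Data.Nat.Combinatorics using (_C_)
open import Data.List using (List; []; _∷_; _++_; [_]; replicate; map; upTo; take; length)
import Data.List as L
open import Data.List.Relation.Unary.All using (All)
open import Data.List.Relation.Unary.Linked using (Linked)
open import Data.Product using (_×_)
open import Relation.Binary.PropositionalEquality using (_≡_)
open import Data.Integer using (+_)
open import Data.Nat.ListAction using (sum)
open import Data.Rational using (ℚ; 1ℚ; 0ℚ; _/_; _*_; _+_)

-- β = 1.6740 = 837/500, an exact rational
β : ℚ
β = + 837 / 500

_^ℚ_ : ℚ → ℕ → ℚ
x ^ℚ zero = 1ℚ
x ^ℚ suc k = x * (x ^ℚ k)

G : List ℕ → ℚ
G s = L.foldr _+_ 0ℚ (map (β ^ℚ_) s)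

record InS (n : ℕ) (s : List ℕ) : Set where
  field
    len       : length s ≡ n
    nondecr   : Linked _≤_ s
    prefix    : ∀ k → 1 ≤ k → k < n → suc (k C 2) ≤ sum (take k s)
    total     : sum s ≡ n C 2
    bounds    : All (λ x → 3 ≤ x × x ≤ n ∸ 4) s

-- the extremal sequence σ(n) (only meaningful for n ≥ 11)
σ : ℕ → List ℕ
σ 11 = 3 ∷ 3 ∷ 3 ∷ 3 ∷ 3 ∷ 5 ∷ 7 ∷ 7 ∷ 7 ∷ 7 ∷ 7 ∷ []
σ 12 = 3 ∷ 3 ∷ 3 ∷ 3 ∷ 3 ∷ 3 ∷ 8 ∷ 8 ∷ 8 ∷ 8 ∷ 8 ∷ 8 ∷ []
σ 13 = 3 ∷ 3 ∷ 3 ∷ 3 ∷ 3 ∷ 3 ∷ 6 ∷ 9 ∷ 9 ∷ 9 ∷ 9 ∷ 9 ∷ 9 ∷ []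
σ n = replicate 6 3 ++ [ 4 ] ++ map (7 Data.Nat.+_) (upTo (n ∸ 14))
        ++ [ n ∸ 5 ] ++ replicate 6 (n ∸ 4)

private
  open import Relation.Binary.PropositionalEquality using (refl)
  _ : σ 15 ≡ 3 ∷ 3 ∷ 3 ∷ 3 ∷ 3 ∷ 3 ∷ 4 ∷ 7 ∷ 10 ∷ 11 ∷ 11 ∷ 11 ∷ 11 ∷ 11 ∷ 11 ∷ []
  _ = refl

module Submission where

-- (I)  Convexity.  Since x ↦ β^x has nonnegative second differences e, it
--      expands as f x = f 0 + x·d 0 + Σ_u (x ∸ (u+1))·e u; so for lists of equal
--      length and sum, G grows with the excesses excess s v = Σ_w (s_w ∸ v).
-- (II) Majorisation.  If s is nondecreasing, has the length and sum of t, and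
--      dominates t in every prefix sum, then each excess of s is at most t's.
-- Every s ∈ S_n has three lower bounds on its k-th prefix sum: 3k, C(k,2)+1
-- and C(n,2) − (n−k)(n−4).  A t ∈ S_n attaining one of them at every k is
-- dominated by all of S_n in (II), hence maximises G by (I).  For n = 11, 12,
-- 13 this is decided by computation; for n = 14 + m the prefix sums of σ(n)
-- are computed in closed form on its three segments: the six 3s and the 4,
-- the run 7, …, m+6, and the last seven entries.

open import Defs
open import Data.Nat using (ℕ; _≤_)
open import Data.List using (List)
open import Data.Product using (_×_)
import Data.Rational as Q

open import Data.Nat using (zero; suc; _∸_; _<_; z≤n; s≤s; _≤?_; _<?_; _≟_)
import Data.Nat.Properties as ℕP
open import Data.Nat.Combinatorics using (_C_; nCk+nC[k+1]≡[n+1]C[k+1]; nC1≡n)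
open import Data.Nat.ListAction using (sum)
open import Data.Nat.ListAction.Properties using (sum-++)
import Data.Nat.Solver as ℕ-Solver
open import Data.List using ([]; _∷_; _++_; map; length; take; drop; replicate)
import Data.List.Properties as LP
open import Data.List.Relation.Unary.All as All using (All; []; _∷_; all?)
import Data.List.Relation.Unary.All.Properties as AllP
open import Data.List.Relation.Unary.Linked as Linked using (Linked; []; [-]; _∷_; linked?)
open import Data.List.Relation.Unary.Linked.Properties using (Linked⇒All)
open import Data.Product using (_,_; proj₁; proj₂; ∃-syntax)
open import Data.Sum using (_⊎_; inj₁; inj₂)
open import Relation.Binary.PropositionalEquality
open import Relation.Nullary using (Dec; map′)
open import Relation.Nullary.Decidable using (True; yes; no; toWitness; from-yes; _×-dec_; _⊎-dec_; _→-dec_)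

excess : List ℕ → ℕ → ℕ
excess s v = sum (map (_∸ v) s)

prefixSum : ℕ → List ℕ → ℕ
prefixSum k s = sum (take k s)

-- (I) Sums of a discretely convex function are monotone in the excesses.

module Convexity where

  open import Data.Rational using (ℚ; 0ℚ; 1ℚ; _+_; _-_; _*_)
  import Data.Rational.Properties as ℚP
  open import Data.Rational.Solver using (module +-*-Solver)
  open +-*-Solver

  infixr 7 _·_
  _·_ : ℕ → ℚ → ℚ
  zero  · y = 0ℚ
  suc k · y = y + k · y

  ·-distribʳ : ∀ a b y → (a Data.Nat.+ b) · y ≡ a · y + b · y
  ·-distribʳ zero    b y = sym (ℚP.+-identityˡ _)
  ·-distribʳ (suc a) b y = trans (cong (y +_) (·-distribʳ a b y)) (sym (ℚP.+-assoc y _ _))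

  ·-nonneg : ∀ k {y} → 0ℚ Q.≤ y → 0ℚ Q.≤ k · y
  ·-nonneg zero    y≥0 = ℚP.≤-refl
  ·-nonneg (suc k) y≥0 = ℚP.+-mono-≤ y≥0 (·-nonneg k y≥0)

  ·-monoˡ : ∀ {a b y} → a ≤ b → 0ℚ Q.≤ y → a · y Q.≤ b · y
  ·-monoˡ {b = b} z≤n       y≥0 = ·-nonneg b y≥0
  ·-monoˡ {y = y} (s≤s a≤b) y≥0 = ℚP.+-monoʳ-≤ y (·-monoˡ a≤b y≥0)

  sumBelow : ℕ → (ℕ → ℚ) → ℚ
  sumBelow zero    g = 0ℚ
  sumBelow (suc k) g = g k + sumBelow k g

  sumBelow-cong : ∀ k {g h} → (∀ u → u < k → g u ≡ h u) → sumBelow k g ≡ sumBelow k h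
  sumBelow-cong zero    g≡h = refl
  sumBelow-cong (suc k) g≡h =
    cong₂ _+_ (g≡h k ℕP.≤-refl) (sumBelow-cong k (λ u u<k → g≡h u (ℕP.m≤n⇒m≤1+n u<k)))

  interchange : ∀ a b c d → (a + b) + (c + d) ≡ (a + c) + (b + d)
  interchange = solve 4 (λ a b c d → (a :+ b) :+ (c :+ d) := (a :+ c) :+ (b :+ d)) refl

  sumBelow-+ : ∀ k g h → sumBelow k (λ u → g u + h u) ≡ sumBelow k g + sumBelow k h
  sumBelow-+ zero    g h = sym (ℚP.+-identityˡ _)
  sumBelow-+ (suc k) g h =
    trans (cong (g k + h k +_) (sumBelow-+ k g h)) (interchange (g k) (h k) (sumBelow k g) (sumBelow k h))

  sumBelow-zero : ∀ k → sumBelow k (λ _ → 0ℚ) ≡ 0ℚ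
  sumBelow-zero zero    = refl
  sumBelow-zero (suc k) = trans (ℚP.+-identityˡ _) (sumBelow-zero k)

  sumBelow-mono : ∀ k {g h} → (∀ u → g u Q.≤ h u) → sumBelow k g Q.≤ sumBelow k h
  sumBelow-mono zero    g≤h = ℚP.≤-refl
  sumBelow-mono (suc k) g≤h = ℚP.+-mono-≤ (g≤h k) (sumBelow-mono k g≤h)

  module Expansion (f d e : ℕ → ℚ)
                   (f-step : ∀ x → f (suc x) ≡ f x + d x)
                   (d-step : ∀ x → d (suc x) ≡ d x + e x) where

    -- The weight (x ∸ (u+1)) with which the second difference e u enters f x.
    ramp : ℕ → ℕ → ℚ
    ramp x u = (x ∸ suc u) · e u

    d-expansion : ∀ x → d x ≡ d 0 + sumBelow x e
    d-expansion zero    = sym (ℚP.+-identityʳ _)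
    d-expansion (suc x) = trans (d-step x) (trans (cong (_+ e x) (d-expansion x))
      (solve 3 (λ a b c → (a :+ b) :+ c := a :+ (c :+ b)) refl (d 0) (sumBelow x e) (e x)))

    ramp-suc : ∀ x → sumBelow x (ramp (suc x)) ≡ sumBelow x e + sumBelow x (ramp x)
    ramp-suc x = trans (sumBelow-cong x (λ u u<x → cong (_· e u) (ℕP.+-∸-assoc 1 u<x)))
                       (sumBelow-+ x e (ramp x))

    f-expansion : ∀ x → f x ≡ f 0 + (x · d 0 + sumBelow x (ramp x))
    f-expansion zero    = sym (trans (cong (f 0 +_) (ℚP.+-identityʳ 0ℚ)) (ℚP.+-identityʳ _))
    f-expansion (suc x) = begin
      f (suc x)                                                   ≡⟨ f-step x ⟩
      f x + d x                                                   ≡⟨ cong₂ _+_ (f-expansion x) (d-expansion x) ⟩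
      (f 0 + (x · d 0 + sumBelow x (ramp x))) + (d 0 + sumBelow x e)
        ≡⟨ solve 5 (λ a b c p q → (a :+ (b :+ c)) :+ (p :+ q) := a :+ ((p :+ b) :+ (con 0ℚ :+ (q :+ c))))
                 refl (f 0) (x · d 0) (sumBelow x (ramp x)) (d 0) (sumBelow x e) ⟩
      f 0 + (suc x · d 0 + (0 · e x + (sumBelow x e + sumBelow x (ramp x))))
        ≡⟨ cong (λ z → f 0 + (suc x · d 0 + (z · e x + (sumBelow x e + sumBelow x (ramp x))))) (sym (ℕP.n∸n≡0 x)) ⟩
      f 0 + (suc x · d 0 + (ramp (suc x) x + (sumBelow x e + sumBelow x (ramp x))))
        ≡⟨ cong (λ z → f 0 + (suc x · d 0 + (ramp (suc x) x + z))) (sym (ramp-suc x)) ⟩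
      f 0 + (suc x · d 0 + sumBelow (suc x) (ramp (suc x)))       ∎
      where open ≡-Reasoning

    -- Since ramp x u = 0 for u ≥ x, the expansion holds with any range M ≥ x.
    ramp-beyond : ∀ x M → x ≤ M → sumBelow M (ramp x) ≡ sumBelow x (ramp x)
    ramp-beyond x zero    z≤n = refl
    ramp-beyond x (suc M) x≤1+M with ℕP.m≤n⇒m<n∨m≡n x≤1+M
    ... | inj₂ refl      = refl
    ... | inj₁ (s≤s x≤M) =
      trans (cong (λ z → z · e M + sumBelow M (ramp x)) (ℕP.m≤n⇒m∸n≡0 (ℕP.m≤n⇒m≤1+n x≤M)))
            (trans (ℚP.+-identityˡ _) (ramp-beyond x M x≤M))

    f-expansion≤ : ∀ M x → x ≤ M → f x ≡ f 0 + (x · d 0 + sumBelow M (ramp x))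
    f-expansion≤ M x x≤M = trans (f-expansion x) (cong (λ z → f 0 + (x · d 0 + z)) (sym (ramp-beyond x M x≤M)))

    Φ : List ℕ → ℚ
    Φ s = Data.List.foldr _+_ 0ℚ (map f s)

    Φ-expansion : ∀ M s → All (_≤ M) s →
                  Φ s ≡ length s · f 0 + (sum s · d 0 + sumBelow M (λ u → excess s (suc u) · e u))
    Φ-expansion M [] [] =
      sym (trans (ℚP.+-identityˡ _) (trans (ℚP.+-identityˡ _) (sumBelow-zero M)))
    Φ-expansion M (x ∷ s) (x≤M ∷ s≤M) = begin
      f x + Φ s
        ≡⟨ cong₂ _+_ (f-expansion≤ M x x≤M) (Φ-expansion M s s≤M) ⟩
      (f 0 + (x · d 0 + sumBelow M (ramp x))) + (length s · f 0 + (sum s · d 0 + E s))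
        ≡⟨ trans (interchange (f 0) _ (length s · f 0) _)
                 (cong (f 0 + length s · f 0 +_) (interchange (x · d 0) _ (sum s · d 0) _)) ⟩
      (f 0 + length s · f 0) + ((x · d 0 + sum s · d 0) + (sumBelow M (ramp x) + E s))
        ≡⟨ cong₂ (λ p q → (f 0 + length s · f 0) + (p + q)) (sym (·-distribʳ x (sum s) (d 0)))
             (trans (sym (sumBelow-+ M (ramp x) (λ u → excess s (suc u) · e u)))
                    (sumBelow-cong M (λ u _ → sym (·-distribʳ (x ∸ suc u) (excess s (suc u)) (e u))))) ⟩
      length (x ∷ s) · f 0 + (sum (x ∷ s) · d 0 + E (x ∷ s))
        ∎
      where
        open ≡-Reasoning
        E : List ℕ → ℚ
        E t = sumBelow M (λ u → excess t (suc u) · e u)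

    Φ-mono : ∀ M s t → All (_≤ M) s → All (_≤ M) t → length s ≡ length t → sum s ≡ sum t →
             (∀ v → excess s v ≤ excess t v) → (∀ u → 0ℚ Q.≤ e u) → Φ s Q.≤ Φ t
    Φ-mono M s t s≤M t≤M |s|≡|t| Σs≡Σt s≼t e≥0 =
      subst₂ Q._≤_ (sym (trans (Φ-expansion M s s≤M) (cong₂ (λ p q → p · f 0 + (q · d 0 + _)) |s|≡|t| Σs≡Σt)))
                   (sym (Φ-expansion M t t≤M))
        (ℚP.+-monoʳ-≤ (length t · f 0) (ℚP.+-monoʳ-≤ (sum t · d 0)
          (sumBelow-mono M (λ u → ·-monoˡ (s≼t (suc u)) (e≥0 u)))))

  c : ℚ
  c = β - 1ℚ

  Δβ Δ²β : ℕ → ℚ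
  Δβ  x = β ^ℚ x * c
  Δ²β x = β ^ℚ x * (c * c)

  β-step : ∀ x → β ^ℚ suc x ≡ β ^ℚ x + Δβ x
  β-step x = solve 2 (λ C p → (con 1ℚ :+ C) :* p := p :+ p :* C) refl c (β ^ℚ x)

  Δβ-step : ∀ x → Δβ (suc x) ≡ Δβ x + Δ²β x
  Δβ-step x = solve 2 (λ C p → (con 1ℚ :+ C) :* p :* C := p :* C :+ p :* (C :* C)) refl c (β ^ℚ x)

  β^≥0 : ∀ x → 0ℚ Q.≤ β ^ℚ x
  β^≥0 zero    = ℚP.nonNegative⁻¹ 1ℚ
  β^≥0 (suc x) = subst (Q._≤ β * β ^ℚ x) (ℚP.*-zeroʳ β) (ℚP.*-monoˡ-≤-nonNeg β (β^≥0 x))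

  Δ²β≥0 : ∀ x → 0ℚ Q.≤ Δ²β x
  Δ²β≥0 x = subst (Q._≤ Δ²β x) (ℚP.*-zeroˡ (c * c)) (ℚP.*-monoʳ-≤-nonNeg (c * c) (β^≥0 x))

  G-mono : ∀ M s t → All (_≤ M) s → All (_≤ M) t → length s ≡ length t → sum s ≡ sum t →
           (∀ v → excess s v ≤ excess t v) → G s Q.≤ G t
  G-mono M s t s≤M t≤M |s|≡|t| Σs≡Σt s≼t =
    Φ-mono M s t s≤M t≤M |s|≡|t| Σs≡Σt s≼t Δ²β≥0
    where open Expansion (β ^ℚ_) Δβ Δ²β β-step Δβ-step

open Convexity using (G-mono)
open import Data.Nat using (_+_; _*_)
open ℕ-Solver.+-*-Solver

-- (II) Prefix-sum domination of a nondecreasing list controls the excesses.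

sum≡prefix+rest : ∀ k s → sum s ≡ prefixSum k s + sum (drop k s)
sum≡prefix+rest k s = trans (cong sum (sym (LP.take++drop≡id k s))) (sum-++ (take k s) (drop k s))

excess-drop : ∀ k t v → excess (drop k t) v ≤ excess t v
excess-drop zero    t       v = ℕP.≤-refl
excess-drop (suc k) []      v = z≤n
excess-drop (suc k) (x ∷ t) v = ℕP.≤-trans (excess-drop k t v) (ℕP.m≤n+m (excess t v) (x ∸ v))

sum≤excess+ : ∀ t v → sum t ≤ excess t v + length t * v
sum≤excess+ []      v = z≤n
sum≤excess+ (x ∷ t) v = subst (x + sum t ≤_)
  (solve 4 (λ a v b c → (v :+ a) :+ (b :+ c) := (a :+ b) :+ (v :+ c)) refl (x ∸ v) v (excess t v) (length t * v))
  (ℕP.+-mono-≤ (ℕP.m≤n+m∸n x v) (sum≤excess+ t v))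

sum≤excess+prefix : ∀ t k v → sum t ≤ excess t v + (length (drop k t) * v + prefixSum k t)
sum≤excess+prefix t k v = begin
  sum t                                              ≡⟨ sum≡prefix+rest k t ⟩
  prefixSum k t + sum (drop k t)                     ≤⟨ ℕP.+-monoʳ-≤ (prefixSum k t) (sum≤excess+ (drop k t) v) ⟩
  prefixSum k t + (excess (drop k t) v + L)          ≤⟨ ℕP.+-monoʳ-≤ (prefixSum k t) (ℕP.+-monoˡ-≤ L (excess-drop k t v)) ⟩
  prefixSum k t + (excess t v + L)                   ≡⟨ solve 3 (λ p e l → p :+ (e :+ l) := e :+ (l :+ p)) refl (prefixSum k t) (excess t v) L ⟩
  excess t v + (L + prefixSum k t)                   ∎
  where
    open ℕP.≤-Reasoning
    L = length (drop k t) * v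

excess-above : ∀ s v → All (v ≤_) s → excess s v + length s * v ≡ sum s
excess-above []      v []           = refl
excess-above (x ∷ s) v (v≤x ∷ v≤s) = begin
  (x ∸ v + excess s v) + (v + length s * v)
    ≡⟨ solve 4 (λ a b v c → (a :+ b) :+ (v :+ c) := (a :+ v) :+ (b :+ c)) refl (x ∸ v) (excess s v) v (length s * v) ⟩
  (x ∸ v + v) + (excess s v + length s * v)  ≡⟨ cong₂ _+_ (ℕP.m∸n+n≡m v≤x) (excess-above s v v≤s) ⟩
  x + sum s                                  ∎
  where open ≡-Reasoning

-- In a nondecreasing list the bound is attained by cutting after the entries ≤ v.
threshold-split : ∀ s → Linked _≤_ s → ∀ v →
  ∃[ k ] k ≤ length s × excess s v + (length (drop k s) * v + prefixSum k s) ≡ sum s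
threshold-split []      _      v = 0 , z≤n , refl
threshold-split (x ∷ r) sorted v with x ≤? v
... | yes x≤v =
  let (k , k≤|r| , eq) = threshold-split r (Linked.tail sorted) v
      L = length (drop k r) * v
  in suc k , s≤s k≤|r| , (begin
    (x ∸ v + excess r v) + (L + (x + prefixSum k r))  ≡⟨ cong (λ z → (z + excess r v) + (L + (x + prefixSum k r))) (ℕP.m≤n⇒m∸n≡0 x≤v) ⟩
    excess r v + (L + (x + prefixSum k r))            ≡⟨ solve 4 (λ e l x p → e :+ (l :+ (x :+ p)) := x :+ (e :+ (l :+ p))) refl (excess r v) L x (prefixSum k r) ⟩
    x + (excess r v + (L + prefixSum k r))            ≡⟨ cong (x +_) eq ⟩
    x + sum r                                         ∎)
  where open ≡-Reasoning
... | no x≰v = 0 , z≤n , trans (cong (excess (x ∷ r) v +_) (ℕP.+-identityʳ _))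
                    (excess-above (x ∷ r) v (Linked⇒All ℕP.≤-trans (ℕP.<⇒≤ (ℕP.≰⇒> x≰v)) sorted))

excess-majorization : ∀ s t → length s ≡ length t → sum s ≡ sum t → Linked _≤_ s →
  (∀ k → k ≤ length s → prefixSum k t ≤ prefixSum k s) → ∀ v → excess s v ≤ excess t v
excess-majorization s t |s|≡|t| Σs≡Σt sorted dominated v with threshold-split s sorted v
... | k , k≤|s| , split = ℕP.+-cancelʳ-≤ (L + prefixSum k s) (excess s v) (excess t v) (begin
  excess s v + (L + prefixSum k s)                             ≡⟨ split ⟩
  sum s                                                        ≡⟨ Σs≡Σt ⟩
  sum t                                                        ≤⟨ sum≤excess+prefix t k v ⟩
  excess t v + (length (drop k t) * v + prefixSum k t)         ≡⟨ cong (λ z → excess t v + (z * v + prefixSum k t)) |drop-t|≡ ⟩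
  excess t v + (L + prefixSum k t)                             ≤⟨ ℕP.+-monoʳ-≤ (excess t v) (ℕP.+-monoʳ-≤ L (dominated k k≤|s|)) ⟩
  excess t v + (L + prefixSum k s)                             ∎)
  where
    open ℕP.≤-Reasoning
    L = length (drop k s) * v
    |drop-t|≡ : length (drop k t) ≡ length (drop k s)
    |drop-t|≡ = trans (LP.length-drop k t) (trans (cong (_∸ k) (sym |s|≡|t|)) (sym (LP.length-drop k s)))

-- Prefix-sum lower bounds on S_n, and the maximality criterion.

C2-suc : ∀ n → suc n C 2 ≡ n C 2 + n
C2-suc n = trans (sym (nCk+nC[k+1]≡[n+1]C[k+1] n 1)) (trans (cong (_+ n C 2) (nC1≡n n)) (ℕP.+-comm n _))

C2-+ : ∀ a b → (a + b) C 2 ≡ a C 2 + a * b + b C 2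
C2-+ zero    b = refl
C2-+ (suc a) b = begin
  suc (a + b) C 2                      ≡⟨ C2-suc (a + b) ⟩
  (a + b) C 2 + (a + b)                ≡⟨ cong (_+ (a + b)) (C2-+ a b) ⟩
  a C 2 + a * b + b C 2 + (a + b)      ≡⟨ solve 4 (λ A a b B → A :+ a :* b :+ B :+ (a :+ b) := A :+ a :+ (b :+ a :* b) :+ B) refl (a C 2) a b (b C 2) ⟩
  a C 2 + a + suc a * b + b C 2        ≡⟨ cong (λ z → z + suc a * b + b C 2) (sym (C2-suc a)) ⟩
  suc a C 2 + suc a * b + b C 2        ∎
  where open ≡-Reasoning

prefixSum≥ : ∀ {c} s → All (c ≤_) s → ∀ k → k ≤ length s → k * c ≤ prefixSum k s
prefixSum≥ s       c≤s       zero    _         = z≤n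
prefixSum≥ (x ∷ s) (c≤x ∷ c≤s) (suc k) (s≤s k≤|s|) = ℕP.+-mono-≤ c≤x (prefixSum≥ s c≤s k k≤|s|)

sum≤ : ∀ {b} t → All (_≤ b) t → sum t ≤ length t * b
sum≤ []      []          = z≤n
sum≤ (x ∷ t) (x≤b ∷ t≤b) = ℕP.+-mono-≤ x≤b (sum≤ t t≤b)

module _ {n s} (s∈S : InS n s) where
  open InS s∈S

  prefixSum≥3k : ∀ k → k ≤ n → k * 3 ≤ prefixSum k s
  prefixSum≥3k k k≤n = prefixSum≥ s (All.map proj₁ bounds) k (subst (k ≤_) (sym len) k≤n)

  total≤prefix+rest : ∀ k → n C 2 ≤ prefixSum k s + (n ∸ k) * (n ∸ 4)
  total≤prefix+rest k = begin
    n C 2                                         ≡⟨ sym total ⟩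
    sum s                                         ≡⟨ sum≡prefix+rest k s ⟩
    prefixSum k s + sum (drop k s)                ≤⟨ ℕP.+-monoʳ-≤ (prefixSum k s) (sum≤ (drop k s) (AllP.drop⁺ k (All.map proj₂ bounds))) ⟩
    prefixSum k s + length (drop k s) * (n ∸ 4)   ≡⟨ cong (λ z → prefixSum k s + z * (n ∸ 4)) (trans (LP.length-drop k s) (cong (_∸ k) len)) ⟩
    prefixSum k s + (n ∸ k) * (n ∸ 4)             ∎
    where open ℕP.≤-Reasoning

Attains : ℕ → ℕ → ℕ → Set
Attains n k p = p ≤ k * 3 ⊎ ((1 ≤ k × k < n) × p ≤ suc (k C 2)) ⊎ p + (n ∸ k) * (n ∸ 4) ≤ n C 2

attains⇒≤ : ∀ {n s k p} → InS n s → k ≤ n → Attains n k p → p ≤ prefixSum k s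
attains⇒≤ {k = k} s∈S k≤n (inj₁ p≤3k) = ℕP.≤-trans p≤3k (prefixSum≥3k s∈S k k≤n)
attains⇒≤ {k = k} s∈S k≤n (inj₂ (inj₁ ((1≤k , k<n) , p≤))) = ℕP.≤-trans p≤ (InS.prefix s∈S k 1≤k k<n)
attains⇒≤ {n} {k = k} s∈S k≤n (inj₂ (inj₂ p+rest≤)) =
  ℕP.+-cancelʳ-≤ ((n ∸ k) * (n ∸ 4)) _ _ (ℕP.≤-trans p+rest≤ (total≤prefix+rest s∈S k))

PrefixMinimal : ℕ → List ℕ → Set
PrefixMinimal n t = ∀ k → k ≤ n → Attains n k (prefixSum k t)

Maximiser : ℕ → List ℕ → Set
Maximiser n t = InS n t × ((s : List ℕ) → InS n s → G s Q.≤ G t)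

prefixMinimal⇒maximiser : ∀ n t → InS n t → PrefixMinimal n t → Maximiser n t
prefixMinimal⇒maximiser n t t∈S minimal = t∈S , λ s s∈S →
  G-mono n s t (bounded s∈S) (bounded t∈S) (same-length s∈S) (same-sum s∈S)
    (excess-majorization s t (same-length s∈S) (same-sum s∈S) (InS.nondecr s∈S) (dominated s∈S))
  where
    same-length : ∀ {s} → InS n s → length s ≡ length t
    same-length s∈S = trans (InS.len s∈S) (sym (InS.len t∈S))
    same-sum : ∀ {s} → InS n s → sum s ≡ sum t
    same-sum s∈S = trans (InS.total s∈S) (sym (InS.total t∈S))
    bounded : ∀ {l} → InS n l → All (_≤ n) l
    bounded l∈S = All.map (λ b → ℕP.≤-trans (proj₂ b) (ℕP.m∸n≤m n 4)) (InS.bounds l∈S)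
    dominated : ∀ {s} → InS n s → ∀ k → k ≤ length s → prefixSum k t ≤ prefixSum k s
    dominated s∈S k k≤|s| = attains⇒≤ s∈S k≤n (minimal k k≤n)
      where k≤n = subst (k ≤_) (InS.len s∈S) k≤|s|

Attains? : ∀ n k p → Dec (Attains n k p)
Attains? n k p = (p ≤? k * 3) ⊎-dec (((1 ≤? k) ×-dec (k <? n)) ×-dec (p ≤? suc (k C 2)))
                   ⊎-dec (p + (n ∸ k) * (n ∸ 4) ≤? n C 2)

∀≤? : ∀ {P : ℕ → Set} → (∀ k → Dec (P k)) → ∀ n → Dec (∀ k → k ≤ n → P k)
∀≤? P? n = map′ (λ all<1+n k k≤n → all<1+n (s≤s k≤n)) (λ all≤n {k} k<1+n → all≤n k (ℕP.≤-pred k<1+n))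
                (ℕP.allUpTo? P? (suc n))

PrefixMinimal? : ∀ n t → Dec (PrefixMinimal n t)
PrefixMinimal? n t = ∀≤? (λ k → Attains? n k (prefixSum k t)) n

InS? : ∀ n s → Dec (InS n s)
InS? n s = map′ (λ (len , nondecr , prefix , total , bounds) →
                   record { len = len ; nondecr = nondecr ; total = total ; bounds = bounds
                          ; prefix = λ k 1≤k k<n → prefix k (ℕP.<⇒≤ k<n) 1≤k k<n })
                (λ s∈S → InS.len s∈S , InS.nondecr s∈S , (λ k _ → InS.prefix s∈S k) , InS.total s∈S , InS.bounds s∈S)
                ((length s ≟ n) ×-dec linked? _≤?_ s
                  ×-dec ∀≤? (λ k → (1 ≤? k) →-dec ((k <? n) →-dec (suc (k C 2) ≤? prefixSum k s))) n
                  ×-dec (sum s ≟ n C 2) ×-dec all? (λ x → (3 ≤? x) ×-dec (x ≤? n ∸ 4)) s)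

maximiser-by-computation : ∀ n {σ∈S : True (InS? n (σ n))} {minimal : True (PrefixMinimal? n (σ n))} →
                           Maximiser n (σ n)
maximiser-by-computation n {σ∈S} {minimal} =
  prefixMinimal⇒maximiser n (σ n) (toWitness σ∈S) (toWitness minimal)

-- The sequence σ(14 + m) and its prefix sums.

run : ℕ → ℕ → List ℕ
run a zero    = []
run a (suc m) = a ∷ run (suc a) m

applyUpTo≡run : ∀ m f a → (∀ i → f i ≡ a + i) → Data.List.applyUpTo f m ≡ run a m
applyUpTo≡run zero    f a f≡ = refl
applyUpTo≡run (suc m) f a f≡ = cong₂ _∷_ (trans (f≡ 0) (ℕP.+-identityʳ a))
  (applyUpTo≡run m (λ i → f (suc i)) (suc a) (λ i → trans (f≡ (suc i)) (ℕP.+-suc a i)))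

length-run : ∀ a m → length (run a m) ≡ m
length-run a zero    = refl
length-run a (suc m) = cong suc (length-run (suc a) m)

sum-run : ∀ a m → sum (run a m) ≡ m * a + m C 2
sum-run a zero    = refl
sum-run a (suc m) = begin
  a + sum (run (suc a) m)     ≡⟨ cong (a +_) (sum-run (suc a) m) ⟩
  a + (m * suc a + m C 2)     ≡⟨ solve 3 (λ a m M → a :+ (m :* (con 1 :+ a) :+ M) := a :+ m :* a :+ (M :+ m)) refl a m (m C 2) ⟩
  suc m * a + (m C 2 + m)     ≡⟨ cong (suc m * a +_) (sym (C2-suc m)) ⟩
  suc m * a + suc m C 2       ∎
  where open ≡-Reasoning

take-run : ∀ a {j m} → j ≤ m → take j (run a m) ≡ run a j
take-run a z≤n               = refl
take-run a (s≤s j≤m) = cong (a ∷_) (take-run (suc a) j≤m)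

prefixSum-++ˡ : ∀ {j} xs ys → j ≤ length xs → prefixSum j (xs ++ ys) ≡ prefixSum j xs
prefixSum-++ˡ {zero}  xs       ys _              = refl
prefixSum-++ˡ {suc j} (x ∷ xs) ys (s≤s j≤|xs|) = cong (x +_) (prefixSum-++ˡ xs ys j≤|xs|)

prefixSum-++ʳ : ∀ xs ys j → prefixSum (length xs + j) (xs ++ ys) ≡ sum xs + prefixSum j ys
prefixSum-++ʳ []       ys j = refl
prefixSum-++ʳ (x ∷ xs) ys j = trans (cong (x +_) (prefixSum-++ʳ xs ys j)) (sym (ℕP.+-assoc x _ _))

prefixSum-replicate : ∀ {j n} c → j ≤ n → prefixSum j (replicate n c) ≡ j * c
prefixSum-replicate c z≤n       = refl
prefixSum-replicate c (s≤s j≤n) = cong (c +_) (prefixSum-replicate c j≤n)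

linked-run : ∀ {x a} m r → x ≤ a → Linked _≤_ (a + m ∷ r) → Linked _≤_ (x ∷ run a m ++ r)
linked-run         zero    []      x≤a _             = [-]
linked-run {a = a} zero    (y ∷ r) x≤a (a+0≤y ∷ rest) = ℕP.≤-trans x≤a (subst (_≤ y) (ℕP.+-identityʳ a) a+0≤y) ∷ rest
linked-run {a = a} (suc m) r       x≤a sorted        =
  x≤a ∷ linked-run m r (ℕP.n≤1+n a) (subst (λ z → Linked _≤_ (z ∷ r)) (ℕP.+-suc a m) sorted)

σ-large : ℕ → List ℕ
σ-large m = replicate 6 3 ++ 4 ∷ run 7 m ++ (9 + m) ∷ replicate 6 (10 + m)

σ≡σ-large : ∀ m → σ (14 + m) ≡ σ-large m
σ≡σ-large m = cong (λ r → replicate 6 3 ++ 4 ∷ r ++ (9 + m) ∷ replicate 6 (10 + m))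
  (trans (LP.map-upTo (7 +_) m) (applyUpTo≡run m (7 +_) 7 (λ _ → refl)))

data Segment (m : ℕ) : ℕ → Set where
  head : ∀ {k} → k ≤ 6 → Segment m k
  body : ∀ {j} → j ≤ m → Segment m (7 + j)
  tail : ∀ {i} → i ≤ 6 → Segment m (7 + m + suc i)

segment : ∀ m k → k ≤ 14 + m → Segment m k
segment m k k≤14+m with k ≤? 6 | k ≤? 7 + m
... | yes k≤6 | _        = head k≤6
... | no  k≰6 | yes k≤7+m =
  subst (Segment m) (ℕP.m+[n∸m]≡n (ℕP.≰⇒> k≰6)) (body (ℕP.∸-monoˡ-≤ 7 k≤7+m))
... | no  _   | no k≰7+m  =
  subst (Segment m) (trans (ℕP.+-suc (7 + m) _) (ℕP.m+[n∸m]≡n (ℕP.≰⇒> k≰7+m)))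
    (tail (subst (k ∸ (8 + m) ≤_) (ℕP.m+n∸n≡m 6 m) (ℕP.∸-monoˡ-≤ (8 + m) k≤14+m)))

head-prefix : ∀ m {k} → k ≤ 6 → prefixSum k (σ-large m) ≡ k * 3
head-prefix m k≤6 = trans (prefixSum-++ˡ (replicate 6 3) _ k≤6) (prefixSum-replicate 3 k≤6)

body-prefix : ∀ m {j} → j ≤ m → prefixSum (7 + j) (σ-large m) ≡ suc ((7 + j) C 2)
body-prefix m {j} j≤m = begin
  22 + prefixSum j (run 7 m ++ rest)  ≡⟨ cong (22 +_) (prefixSum-++ˡ (run 7 m) rest (subst (j ≤_) (sym (length-run 7 m)) j≤m)) ⟩
  22 + sum (take j (run 7 m))         ≡⟨ cong (λ r → 22 + sum r) (take-run 7 j≤m) ⟩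
  22 + sum (run 7 j)                  ≡⟨ cong (22 +_) (sum-run 7 j) ⟩
  22 + (j * 7 + j C 2)                ≡⟨ solve 2 (λ j J → con 22 :+ (j :* con 7 :+ J) := con 1 :+ (con 21 :+ con 7 :* j :+ J)) refl j (j C 2) ⟩
  suc (7 C 2 + 7 * j + j C 2)         ≡⟨ cong suc (sym (C2-+ 7 j)) ⟩
  suc ((7 + j) C 2)                   ∎
  where
    open ≡-Reasoning
    rest = (9 + m) ∷ replicate 6 (10 + m)

tailSum : ℕ → ℕ → ℕ
tailSum m i = 22 + ((m * 7 + m C 2) + ((9 + m) + i * (10 + m)))

tail-prefix : ∀ m {i} → i ≤ 6 → prefixSum (7 + m + suc i) (σ-large m) ≡ tailSum m i
tail-prefix m {i} i≤6 = begin
  22 + prefixSum (m + suc i) (run 7 m ++ rest)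
    ≡⟨ cong (λ l → 22 + prefixSum (l + suc i) (run 7 m ++ rest)) (sym (length-run 7 m)) ⟩
  22 + prefixSum (length (run 7 m) + suc i) (run 7 m ++ rest)
    ≡⟨ cong (22 +_) (prefixSum-++ʳ (run 7 m) rest (suc i)) ⟩
  22 + (sum (run 7 m) + ((9 + m) + prefixSum i (replicate 6 (10 + m))))
    ≡⟨ cong₂ (λ a b → 22 + (a + ((9 + m) + b))) (sum-run 7 m) (prefixSum-replicate (10 + m) i≤6) ⟩
  tailSum m i
    ∎
  where
    open ≡-Reasoning
    rest = (9 + m) ∷ replicate 6 (10 + m)

-- On the tail the entries equal n − 4, so the prefix sums are exactly C(n,2) − (n−k)(n−4).
tail-complement : ∀ m {i} → i ≤ 6 → tailSum m i + (6 ∸ i) * (10 + m) ≡ (14 + m) C 2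
tail-complement m {i} i≤6 = begin
  tailSum m i + (6 ∸ i) * (10 + m)
    ≡⟨ solve 4 (λ m M i w → con 22 :+ ((m :* con 7 :+ M) :+ ((con 9 :+ m) :+ i :* (con 10 :+ m))) :+ w :* (con 10 :+ m)
                          := con 22 :+ (m :* con 7 :+ M :+ (con 9 :+ m)) :+ (i :+ w) :* (con 10 :+ m)) refl m (m C 2) i (6 ∸ i) ⟩
  22 + (m * 7 + m C 2 + (9 + m)) + (i + (6 ∸ i)) * (10 + m)
    ≡⟨ cong (λ z → 22 + (m * 7 + m C 2 + (9 + m)) + z * (10 + m)) (ℕP.m+[n∸m]≡n i≤6) ⟩
  22 + (m * 7 + m C 2 + (9 + m)) + 6 * (10 + m)
    ≡⟨ solve 2 (λ m M → con 22 :+ (m :* con 7 :+ M :+ (con 9 :+ m)) :+ con 6 :* (con 10 :+ m) := con 91 :+ con 14 :* m :+ M) refl m (m C 2) ⟩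
  14 C 2 + 14 * m + m C 2
    ≡⟨ sym (C2-+ 14 m) ⟩
  (14 + m) C 2
    ∎
  where open ≡-Reasoning

tail-length : ∀ m i → (14 + m) ∸ (7 + m + suc i) ≡ 6 ∸ i
tail-length m i = trans (cong (_∸ (m + suc i)) (ℕP.+-comm 7 m)) (ℕP.[m+n]∸[m+o]≡n∸o m 7 (suc i))

σ-large-minimal : ∀ m → PrefixMinimal (14 + m) (σ-large m)
σ-large-minimal m k k≤n with segment m k k≤n
... | head k≤6 = inj₁ (ℕP.≤-reflexive (head-prefix m k≤6))
... | body j≤m = inj₂ (inj₁ ((s≤s z≤n , ℕP.+-mono-≤ (ℕP.m≤m+n 8 6) j≤m) , ℕP.≤-reflexive (body-prefix m j≤m)))
... | tail {i} i≤6 = inj₂ (inj₂ (ℕP.≤-reflexive (begin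
  prefixSum k (σ-large m) + ((14 + m) ∸ k) * (10 + m)  ≡⟨ cong₂ (λ p r → p + r * (10 + m)) (tail-prefix m i≤6) (tail-length m i) ⟩
  tailSum m i + (6 ∸ i) * (10 + m)                     ≡⟨ tail-complement m i≤6 ⟩
  (14 + m) C 2                                         ∎)))
  where open ≡-Reasoning

head-prefix-bound : ∀ k → 1 ≤ k → k ≤ 6 → suc (k C 2) ≤ k * 3
head-prefix-bound k 1≤k k≤6 =
  from-yes (∀≤? (λ k → (1 ≤? k) →-dec (suc (k C 2) ≤? k * 3)) 6) k k≤6 1≤k

tail-prefix-bound₀ : ∀ i → i ≤ 5 → suc ((8 + i) C 2) ≤ 31 + i * 10
tail-prefix-bound₀ = from-yes (∀≤? (λ i → suc ((8 + i) C 2) ≤? 31 + i * 10) 5)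

tail-prefix-bound : ∀ m {i} → i ≤ 5 → suc ((7 + m + suc i) C 2) ≤ tailSum m i
tail-prefix-bound m {i} i≤5 = begin
  suc ((7 + m + suc i) C 2)                  ≡⟨ cong (λ z → suc (z C 2)) (solve 2 (λ m i → con 7 :+ m :+ (con 1 :+ i) := (con 8 :+ i) :+ m) refl m i) ⟩
  suc ((8 + i + m) C 2)                      ≡⟨ cong suc (C2-+ (8 + i) m) ⟩
  suc ((8 + i) C 2 + (8 + i) * m + m C 2)    ≡⟨ cong suc (ℕP.+-assoc ((8 + i) C 2) _ _) ⟩
  suc ((8 + i) C 2) + ((8 + i) * m + m C 2)  ≤⟨ ℕP.+-monoˡ-≤ ((8 + i) * m + m C 2) (tail-prefix-bound₀ i i≤5) ⟩
  (31 + i * 10) + ((8 + i) * m + m C 2)      ≡⟨ solve 3 (λ i m M → (con 31 :+ i :* con 10) :+ ((con 8 :+ i) :* m :+ M)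
                                                             := con 22 :+ ((m :* con 7 :+ M) :+ ((con 9 :+ m) :+ i :* (con 10 :+ m)))) refl i m (m C 2) ⟩
  tailSum m i                                ∎
  where open ℕP.≤-Reasoning

-- Only the last position of the tail is excluded from the prefix condition.
tail-index≤5 : ∀ m i → 7 + m + suc i < 14 + m → i ≤ 5
tail-index≤5 m i k<n = ℕP.≤-pred (ℕP.≤-pred (ℕP.+-cancelˡ-≤ (7 + m) _ _
  (subst₂ _≤_ (sym (ℕP.+-suc (7 + m) (suc i))) (ℕP.+-comm 7 (7 + m)) k<n)))

σ-large-prefix : ∀ m k → 1 ≤ k → k < 14 + m → suc (k C 2) ≤ prefixSum k (σ-large m)
σ-large-prefix m k 1≤k k<n with segment m k (ℕP.<⇒≤ k<n)
... | head k≤6     = subst (suc (k C 2) ≤_) (sym (head-prefix m k≤6)) (head-prefix-bound k 1≤k k≤6)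
... | body j≤m     = ℕP.≤-reflexive (sym (body-prefix m j≤m))
... | tail {i} i≤6 = subst (suc (k C 2) ≤_) (sym (tail-prefix m i≤6)) (tail-prefix-bound m (tail-index≤5 m i k<n))

length-σ-large : ∀ m → length (σ-large m) ≡ 14 + m
length-σ-large m = cong (7 +_) (trans (LP.length-++ (run 7 m)) (trans (cong (_+ 7) (length-run 7 m)) (ℕP.+-comm m 7)))

sum-σ-large : ∀ m → sum (σ-large m) ≡ (14 + m) C 2
sum-σ-large m = begin
  sum (σ-large m)                         ≡⟨ cong sum (sym (LP.take-all (14 + m) (σ-large m) (ℕP.≤-reflexive (length-σ-large m)))) ⟩
  prefixSum (14 + m) (σ-large m)          ≡⟨ cong (λ k → prefixSum k (σ-large m)) (ℕP.+-comm 7 (7 + m)) ⟩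
  prefixSum (7 + m + 7) (σ-large m)       ≡⟨ tail-prefix m ℕP.≤-refl ⟩
  tailSum m 6                             ≡⟨ sym (ℕP.+-identityʳ _) ⟩
  tailSum m 6 + (6 ∸ 6) * (10 + m)        ≡⟨ tail-complement m ℕP.≤-refl ⟩
  (14 + m) C 2                            ∎
  where open ≡-Reasoning

σ-large∈S : ∀ m → InS (14 + m) (σ-large m)
σ-large∈S m = record
  { len     = length-σ-large m
  ; nondecr = ≤-refl ∷ ≤-refl ∷ ≤-refl ∷ ≤-refl ∷ ≤-refl ∷ ℕP.n≤1+n 3 ∷
              linked-run m ((9 + m) ∷ replicate 6 (10 + m)) (ℕP.m≤m+n 4 3)
                (ℕP.+-monoˡ-≤ m (ℕP.m≤m+n 7 2) ∷ ℕP.n≤1+n (9 + m) ∷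
                 ≤-refl ∷ ≤-refl ∷ ≤-refl ∷ ≤-refl ∷ ≤-refl ∷ [-])
  ; prefix  = σ-large-prefix m
  ; total   = sum-σ-large m
  ; bounds  = AllP.++⁺ (AllP.replicate⁺ 6 (≤-refl , 3≤ 7))
                ((ℕP.n≤1+n 3 , ℕP.≤-trans (ℕP.m≤m+n 4 6) (ℕP.m≤m+n 10 m)) ∷
                 AllP.++⁺ run-bounds
                   ((3≤ 6 , ℕP.n≤1+n (9 + m)) ∷ AllP.replicate⁺ 6 (3≤ 7 , ≤-refl)))
  }
  where
    open ℕP using (≤-refl)
    3≤ : ∀ d → 3 ≤ 3 + d + m
    3≤ d = ℕP.≤-trans (ℕP.m≤m+n 3 d) (ℕP.m≤m+n (3 + d) m)
    run-bounds : All (λ x → 3 ≤ x × x ≤ 10 + m) (run 7 m)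
    run-bounds = subst (All _) (applyUpTo≡run m (7 +_) 7 (λ _ → refl))
      (AllP.applyUpTo⁺₁ (7 +_) m (λ {i} i<m →
        ℕP.≤-trans (ℕP.m≤m+n 3 4) (ℕP.m≤m+n 7 i) , ℕP.+-mono-≤ (ℕP.m≤m+n 7 3) (ℕP.<⇒≤ i<m)))

lemma4 : (n : ℕ) → 11 ≤ n →
    InS n (σ n) × ((s : List ℕ) → InS n s → G s Q.≤ G (σ n))
lemma4 n 11≤n = subst (λ n → Maximiser n (σ n)) (ℕP.m+[n∸m]≡n 11≤n) (maximiser (n ∸ 11))
  where
    maximiser : ∀ m → Maximiser (11 + m) (σ (11 + m))
    maximiser 0 = maximiser-by-computation 11
    maximiser 1 = maximiser-by-computation 12
    maximiser 2 = maximiser-by-computation 13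
    maximiser (suc (suc (suc m))) =
      subst (Maximiser (14 + m)) (sym (σ≡σ-large m))
        (prefixMinimal⇒maximiser (14 + m) (σ-large m) (σ-large∈S m) (σ-large-minimal m))
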